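{- Let $\mathbb{K}_0$ be a proper sub-division ring of the division ring $\mathbb{K}$, and let $\Gamma(\mathbb{K})$ be one of $\mathrm{Gr}_{1,n}(A_n(\mathbb{K}))$ ($n\ge 3$), $\mathrm{Gr}_{1,- }(D_n(\mathbb{K}))$ ($n\ge4$), $\mathrm{Gr}_{1,+,- }(D_n(\mathbb{K}))$ ($n\ge4$) or $\mathrm{Gr}_{+,- }(D_n(\mathbb{K}))$ ($n\ge3$), with $\mathbb{K}$ a field in the $D_n$ cases. Then not every point of $\Gamma(\mathbb{K})$ is nearly $\mathbb{K}_0$-rational.
   Context: Building $A_n(\mathbb{K})$: elements are the subspaces of dimension $1,\dots,n$ of an $(n+1)$-dimensional right $\mathbb{K}$-vector space $V$ with fixed basis $E$ (type = dimension), incidence symmetrized inclusion; diagram: path $1-\cdots-n$. Building $D_n(\mathbb{K})$: $V$ is $2n$-dimensional over the field $\mathbb{K}$ with basis $E=(e_1,\dots,e_{2n})$ and quadratic form $q=x_1x_2+\dots+x_{2n-1}x_{2n}$; the $n$-dimensional totally singular subspaces split into classes $\mathfrak S^{+},\mathfrak S^-$ ($X,Y$ in the same class iff $X\cap Y$ has even codimension in $X$). Elements: totally singular subspaces of dimension $i\in\{1,\dots,n-2\}$ (type $i$) and members of $\mathfrak S^\pm$ (type $\pm$); incidence is symmetrized inclusion except $X\in\mathfrak S^+$, $Y\in\mathfrak S^-$ incident iff $\dim(X\cap Y)=n-1$. Diagram: path $1-\cdots-(n-2)$ with $n-2$ adjacent to $+$ and $-$. A flag is a set of pairwise incident elements.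 $\mathrm{Gr}_J$ has as points the flags of type $J$ and as lines the flags of type $(J\setminus\{j\})\cup\mathrm{fr}(j)$ ($\mathrm{fr}(j)$ = diagram neighbours of $j$), incidence meaning the union is a flag. A vector is $\mathbb{K}_0$-rational if it is a $\mathbb{K}_0$-combination of $E$; a subspace/element is $\mathbb{K}_0$-rational if it has a basis of $\mathbb{K}_0$-rational vectors. A node $t$ splits $J$ if $t\notin J$ and $J$ is not contained in a single connected component of the diagram with $t$ removed. A point $F$ of $\Gamma(\mathbb{K})=\mathrm{Gr}_J(X_n(\mathbb{K}))$ is nearly $\mathbb{K}_0$-rational if some element of $F$ is $\mathbb{K}_0$-rational, or there is a $\mathbb{K}_0$-rational element of $X_n(\mathbb{K})$ incident with $F$ whose type splits $J$. -}

module Defs where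

open import Level using (Level; _⊔_; Lift) renaming (suc to lsuc)
open import Algebra.Bundles using (Ring)
open import Data.Nat using (ℕ; zero; suc; _∸_; _≡ᵇ_)
import Data.Nat as ℕ
open import Data.Nat.Divisibility using (_∣_)
open import Data.Fin using (Fin; toℕ)
open import Data.Bool using (Bool; true; false; T; if_then_else_; _∨_)
open import Data.Product using (Σ; _×_; _,_)
import Data.Product
import Data.Fin
open import Data.Sum using (_⊎_)
open import Data.Unit.Polymorphic using (⊤)
open import Relation.Nullary using (¬_)
open import Relation.Binary.PropositionalEquality using (_≡_)
open import Function using (_∘_)

record DivisionRing (c ℓ : Level) : Set (lsuc (c ⊔ ℓ)) where
  field
    ring : Ring c ℓ
  open Ring ring public
  field
    1≉0     : ¬ (1# ≈ 0#)
    inverse : ∀ x → ¬ (x ≈ 0#) → Σ Carrier λ y → (x * y ≈ 1#) × (y * x ≈ 1#)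

module _ {c ℓ : Level} (K : DivisionRing c ℓ) where
  open DivisionRing K

  IsCommutative : Set (c ⊔ ℓ)
  IsCommutative = ∀ x y → x * y ≈ y * x

  record IsSubDivisionRing {ℓ₀ : Level} (K0 : Carrier → Set ℓ₀) : Set (c ⊔ ℓ ⊔ ℓ₀) where
    field
      resp  : ∀ {x y} → x ≈ y → K0 x → K0 y
      0∈    : K0 0#
      1∈    : K0 1#
      +-cl  : ∀ {x y} → K0 x → K0 y → K0 (x + y)
      neg-cl : ∀ {x} → K0 x → K0 (- x)
      *-cl  : ∀ {x y} → K0 x → K0 y → K0 (x * y)
      inv-cl : ∀ {x y} → K0 x → x * y ≈ 1# → y * x ≈ 1# → K0 y

  Proper : {ℓ₀ : Level} → (Carrier → Set ℓ₀) → Set (c ⊔ ℓ₀)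
  Proper K0 = Σ Carrier λ x → ¬ K0 x

-- Linear algebra in the right K-vector space K^m with standard basis E
-- (vectors are coordinate functions with respect to E).

module LinAlg {c ℓ : Level} (K : DivisionRing c ℓ) where
  open DivisionRing K

  Vect : ℕ → Set c
  Vect m = Fin m → Carrier

  _≈ᵥ_ : ∀ {m} → Vect m → Vect m → Set ℓ
  u ≈ᵥ v = ∀ k → u k ≈ v k

  sumK : ∀ {d} → (Fin d → Carrier) → Carrier
  sumK {zero}  f = 0#
  sumK {suc d} f = f Data.Fin.zero + sumK (f ∘ Data.Fin.suc)

  lc : ∀ {m d} → (Fin d → Vect m) → (Fin d → Carrier) → Vect m
  lc b γ k = sumK (λ i → b i k * γ i)

  LinIndep : ∀ {m d} → (Fin d → Vect m) → Set (c ⊔ ℓ)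
  LinIndep b = ∀ γ → (∀ k → lc b γ k ≈ 0#) → ∀ i → γ i ≈ 0#

  _∈⟨_⟩ : ∀ {m d} → Vect m → (Fin d → Vect m) → Set (c ⊔ ℓ)
  v ∈⟨ b ⟩ = Σ (Fin _ → Carrier) λ γ → v ≈ᵥ lc b γ

  record Sub (m d : ℕ) : Set (c ⊔ ℓ) where
    field
      basis : Fin d → Vect m
      indep : LinIndep basis
  open Sub public

  _∈_ : ∀ {m d} → Vect m → Sub m d → Set (c ⊔ ℓ)
  v ∈ X = v ∈⟨ basis X ⟩

  _⊆_ : ∀ {m d e} → Sub m d → Sub m e → Set (c ⊔ ℓ)
  X ⊆ Y = ∀ v → v ∈ X → v ∈ Y

  SymInc : ∀ {m d e} → Sub m d → Sub m e → Set (c ⊔ ℓ)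
  SymInc X Y = X ⊆ Y ⊎ Y ⊆ X

  DimInter : ∀ {m d e} → Sub m d → (Fin e → Vect m) → ℕ → Set (c ⊔ ℓ)
  DimInter {m} X Y k = Σ (Fin k → Vect m) λ b → LinIndep b ×
    (∀ v → (v ∈⟨ b ⟩ → (v ∈ X) × (v ∈⟨ Y ⟩)) × ((v ∈ X) × (v ∈⟨ Y ⟩) → v ∈⟨ b ⟩))

  module _ {ℓ₀ : Level} (K0 : Carrier → Set ℓ₀) where
    RatVec : ∀ {m} → Vect m → Set ℓ₀
    RatVec v = ∀ k → K0 (v k)

    RatSub : ∀ {m d} → Sub m d → Set (c ⊔ ℓ ⊔ ℓ₀)
    RatSub {m} {d} X = Σ (Fin d → Vect m) λ b → LinIndep b × (∀ i → RatVec (b i)) ×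
      (∀ v → (v ∈⟨ b ⟩ → v ∈ X) × (v ∈ X → v ∈⟨ b ⟩))

  -- coordinate of a vector at a natural-number position (0 if out of range)
  coord : ∀ {m} → Vect m → ℕ → Carrier
  coord {zero}  x k       = 0#
  coord {suc m} x zero    = x Data.Fin.zero
  coord {suc m} x (suc k) = coord (x ∘ Data.Fin.suc) k

  -- standard basis vector e_{k+1} (0-indexed position k)
  unitV : ∀ {m} → ℕ → Vect m
  unitV k j = if toℕ j ≡ᵇ k then 1# else 0#

record Building (a r : Level) : Set (lsuc (a ⊔ r)) where
  field
    Ty   : Set
    adj  : Ty → Ty → Set
    Elem : Ty → Set a
    Inc  : ∀ {s t} → Elem s → Elem t → Set a
    Rat  : ∀ {t} → Elem t → Set r      -- K0-rationality of an element

module _ {a r : Level} (B : Building a r) where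
  open Building B

  data ConnWithout (t : Ty) : Ty → Ty → Set where
    here : ∀ {x} → ¬ x ≡ t → ConnWithout t x x
    step : ∀ {x y z} → ¬ x ≡ t → adj x y → ConnWithout t y z → ConnWithout t x z

  Splits : Ty → (Ty → Bool) → Set
  Splits t J = (J t ≡ false) ×
    ¬ (∀ x y → T (J x) → T (J y) → ConnWithout t x y)

  -- points of Gr_J : flags of type J (pairwise incident elements, one per type in J)
  Point : (Ty → Bool) → Set a
  Point J = Σ (∀ t → T (J t) → Elem t) λ F →
    ∀ s t (js : T (J s)) (jt : T (J t)) → Inc (F s js) (F t jt)

  NearlyRational : (J : Ty → Bool) → Point J → Set (a ⊔ r)
  NearlyRational J (F , _) =
    (Σ Ty λ t → Σ (T (J t)) λ jt → Rat (F t jt))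
    ⊎ (Σ Ty λ t → Σ (Elem t) λ x → Splits t J × Rat x ×
         (∀ s (js : T (J s)) → Inc x (F s js)))

  NotAllNearlyRational : (Ty → Bool) → Set (a ⊔ r)
  NotAllNearlyRational J = ¬ (∀ (F : Point J) → NearlyRational J F)

-- The building A_n(K): V = K^(n+1); types 1..n encoded as Fin n
-- (i : Fin n has type toℕ i + 1 = dimension).

module _ {c ℓ ℓ₀ : Level} (K : DivisionRing c ℓ) (K0 : DivisionRing.Carrier K → Set ℓ₀) where
  open DivisionRing K
  open LinAlg K

  A-building : ℕ → Building (c ⊔ ℓ) (c ⊔ ℓ ⊔ ℓ₀)
  A-building n = record
    { Ty   = Fin n
    ; adj  = λ i j → (suc (toℕ i) ≡ toℕ j) ⊎ (suc (toℕ j) ≡ toℕ i)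
    ; Elem = λ i → Sub (suc n) (suc (toℕ i))
    ; Inc  = SymInc
    ; Rat  = RatSub K0
    }

-- J = {1, n} in A_n
J-A-1n : (n : ℕ) → Fin n → Bool
J-A-1n n i = (toℕ i ≡ᵇ 0) ∨ (toℕ i ≡ᵇ (n ∸ 1))

-- The building D_n(K): V = K^(2n), q = x1x2 + ... + x_{2n-1}x_{2n}.
-- Types: ord i (i : Fin (n-2), type toℕ i + 1), plus (+), minus (-).

data DType (n : ℕ) : Set where
  ord   : Fin (n ∸ 2) → DType n
  plus  : DType n
  minus : DType n

DAdj : (n : ℕ) → DType n → DType n → Set
DAdj n (ord i) (ord j) = (suc (toℕ i) ≡ toℕ j) ⊎ (suc (toℕ j) ≡ toℕ i)
DAdj n (ord i) plus    = suc (toℕ i) ≡ n ∸ 2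
DAdj n (ord i) minus   = suc (toℕ i) ≡ n ∸ 2
DAdj n plus    (ord j) = suc (toℕ j) ≡ n ∸ 2
DAdj n minus   (ord j) = suc (toℕ j) ≡ n ∸ 2
DAdj n plus    plus    = Data.Empty.⊥
  where import Data.Empty
DAdj n plus    minus   = Data.Empty.⊥
  where import Data.Empty
DAdj n minus   plus    = Data.Empty.⊥
  where import Data.Empty
DAdj n minus   minus   = Data.Empty.⊥
  where import Data.Empty

dimD : (n : ℕ) → DType n → ℕ
dimD n (ord i) = suc (toℕ i)
dimD n plus    = n
dimD n minus   = n

module _ {c ℓ : Level} (K : DivisionRing c ℓ) where
  open DivisionRing K
  open LinAlg K

  qform : (n : ℕ) → Vect (2 ℕ.* n) → Carrier
  qform n x = sumK {n} (λ i → coord x (2 ℕ.* toℕ i) * coord x (suc (2 ℕ.* toℕ i)))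

  TotSingular : ∀ n {d} → Sub (2 ℕ.* n) d → Set (c ⊔ ℓ)
  TotSingular n X = ∀ v → v ∈ X → qform n v ≈ 0#

  -- reference maximal totally singular subspace <e1, e3, ..., e_{2n-1}>;
  -- by convention 𝔖⁺ is its class
  P₊ : (n : ℕ) → Fin n → Vect (2 ℕ.* n)
  P₊ n i = unitV (2 ℕ.* toℕ i)

  InSPlus : (n : ℕ) → Sub (2 ℕ.* n) n → Set (c ⊔ ℓ)
  InSPlus n X = Σ ℕ λ k → DimInter X (P₊ n) k × (2 ∣ (n ∸ k))

  InSMinus : (n : ℕ) → Sub (2 ℕ.* n) n → Set (c ⊔ ℓ)
  InSMinus n X = Σ ℕ λ k → DimInter X (P₊ n) k × ¬ (2 ∣ (n ∸ k))

  ClassCond : (n : ℕ) → (t : DType n) → Sub (2 ℕ.* n) (dimD n t) → Set (c ⊔ ℓ)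
  ClassCond n (ord i) X = ⊤
  ClassCond n plus    X = InSPlus n X
  ClassCond n minus   X = InSMinus n X

  ElemD : (n : ℕ) → DType n → Set (c ⊔ ℓ)
  ElemD n t = Σ (Sub (2 ℕ.* n) (dimD n t)) λ X → TotSingular n X × ClassCond n t X

  incD : (n : ℕ) (s t : DType n) → Sub (2 ℕ.* n) (dimD n s) → Sub (2 ℕ.* n) (dimD n t) → Set (c ⊔ ℓ)
  incD n plus  minus X Y = DimInter X (basis Y) (n ∸ 1)
  incD n minus plus  X Y = DimInter X (basis Y) (n ∸ 1)
  incD n s     t     X Y = SymInc X Y

  module _ {ℓ₀ : Level} (K0 : Carrier → Set ℓ₀) where
    D-building : ℕ → Building (c ⊔ ℓ) (c ⊔ ℓ ⊔ ℓ₀)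
    D-building n = record
      { Ty   = DType n
      ; adj  = DAdj n
      ; Elem = ElemD n
      ; Inc  = λ {s} {t} x y → incD n s t (Data.Product.proj₁ x) (Data.Product.proj₁ y)
      ; Rat  = λ x → RatSub K0 (Data.Product.proj₁ x)
      }

-- J = {1, -}, {1, +, -}, {+, -} in D_n (type 1 is ord i with toℕ i = 0)
J-D-1m : (n : ℕ) → DType n → Bool
J-D-1m n (ord i) = toℕ i ≡ᵇ 0
J-D-1m n plus    = false
J-D-1m n minus   = true

J-D-1pm : (n : ℕ) → DType n → Bool
J-D-1pm n (ord i) = toℕ i ≡ᵇ 0
J-D-1pm n plus    = true
J-D-1pm n minus   = true

J-D-pm : (n : ℕ) → DType n → Bool
J-D-pm n (ord i) = false
J-D-pm n plus    = true
J-D-pm n minus   = true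

module Submission where

-- Fix α ∉ K0.  The key fact (rational-obeys-vanishes) is that a K0-rational
-- subspace all of whose vectors satisfy y_{j'} = α y_j lies in the hyperplane
-- y_j = 0: a rational basis vector with y_j ≠ 0 would give α = y_{j'} y_j⁻¹ ∈ K0.
-- We build a flag whose elements all satisfy such a relation and contain a
-- vector with y_j = 1, so none of them is rational; a rational element of a
-- splitting type is then excluded by a dimension count (Steinitz) combined
-- with the key fact.

open import Defs
open import Level using (Level; _⊔_)
open import Data.Nat as ℕ using (ℕ; zero; suc; _≤_; _<_; _∸_; s≤s; z≤n)
import Data.Nat.Properties as ℕP
open import Data.Nat.Divisibility using (_∣_; divides; ∣-refl)
open import Data.Fin as Fin using (Fin; toℕ; punchIn; punchOut)
import Data.Fin.Properties as FinP
open import Data.Product using (Σ; _×_; _,_; proj₁; proj₂)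
open import Data.Sum using (_⊎_; inj₁; inj₂)
open import Data.Empty using (⊥; ⊥-elim)
open import Data.Bool using (Bool; true; false; T; if_then_else_)
import Data.Bool.Properties as BoolP
import Data.Unit.Polymorphic as UP
open import Relation.Nullary using (¬_; Dec; yes; no)
import Relation.Binary.PropositionalEquality as P
open import Function using (_∘_; Equivalence)

-- Double-negation monad: every result proved here is a negation, so we may
-- reason classically (finite excluded middle) inside ¬ ¬.
DN : ∀ {a} → Set a → Set a
DN A = ¬ ¬ A

return : ∀ {a} {A : Set a} → A → DN A
return a ¬a = ¬a a

_>>=_ : ∀ {a b} {A : Set a} {B : Set b} → DN A → (A → DN B) → DN B
(¬¬a >>= f) ¬b = ¬¬a (λ a → f a ¬b)

excluded-middle : ∀ {a} (A : Set a) → DN (A ⊎ ¬ A)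
excluded-middle A k = k (inj₂ (λ a → k (inj₁ a)))

dn-all : ∀ {n p} (Q : Fin n → Set p) → (∀ i → DN (Q i)) → DN (∀ i → Q i)
dn-all {zero}  Q h = return (λ ())
dn-all {suc n} Q h =
  h Fin.zero >>= λ q₀ →
  dn-all (Q ∘ Fin.suc) (h ∘ Fin.suc) >>= λ qₛ →
  return λ { Fin.zero → q₀ ; (Fin.suc i) → qₛ i }

all-or-counterexample : ∀ {n p} (Q : Fin n → Set p) →
  DN ((∀ i → Q i) ⊎ Σ (Fin n) λ i → ¬ Q i)
all-or-counterexample {zero}  Q = return (inj₁ λ ())
all-or-counterexample {suc n} Q = excluded-middle (Q Fin.zero) >>= λ
  { (inj₂ ¬q₀) → return (inj₂ (Fin.zero , ¬q₀))
  ; (inj₁ q₀)  → all-or-counterexample (Q ∘ Fin.suc) >>= λ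
      { (inj₁ qₛ)       → return (inj₁ λ { Fin.zero → q₀ ; (Fin.suc i) → qₛ i })
      ; (inj₂ (i , ¬q)) → return (inj₂ (Fin.suc i , ¬q)) } }

cons : ∀ {a} {A : Set a} {d} → A → (Fin d → A) → Fin (suc d) → A
cons x f Fin.zero    = x
cons x f (Fin.suc i) = f i

if-true : ∀ {a} {A : Set a} (b : Bool) {x y : A} → T b → (if b then x else y) P.≡ x
if-true true _ = P.refl

if-false : ∀ {a} {A : Set a} (b : Bool) {x y : A} → ¬ T b → (if b then x else y) P.≡ y
if-false true  ¬t = ⊥-elim (¬t _)
if-false false _  = P.refl

-- Linear algebra in the right vector space K^m over a division ring K.
module LinearAlgebra {c ℓ : Level} (K : DivisionRing c ℓ) where
  open DivisionRing K public
  open LinAlg K public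
  open import Algebra.Properties.Semiring.Sum semiring
    using (sum; sum-cong-≋; sum-replicate-zero; ∑-distrib-+; ∑-comm; *-distribˡ-sum; *-distribʳ-sum)
  open import Algebra.Properties.Ring ring public using (-‿distribˡ-*; -‿distribʳ-*)
  open import Algebra.Properties.AbelianGroup +-abelianGroup using (⁻¹-∙-comm)
  open import Algebra.Properties.Group +-group public using (ε⁻¹≈ε; ⁻¹-involutive)
  open import Relation.Binary.Reasoning.Setoid setoid public

  sumK≡sum : ∀ {d} (f : Fin d → Carrier) → sumK f P.≡ sum f
  sumK≡sum {zero}  f = P.refl
  sumK≡sum {suc d} f = P.cong (f Fin.zero +_) (sumK≡sum (f ∘ Fin.suc))

  sumK≈ : ∀ {d} {f g : Fin d → Carrier} → sum f ≈ sum g → sumK f ≈ sumK g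
  sumK≈ {d} {f} {g} e = trans (reflexive (sumK≡sum {d} f)) (trans e (reflexive (P.sym (sumK≡sum {d} g))))

  sumK-cong : ∀ {d} {f g : Fin d → Carrier} → (∀ i → f i ≈ g i) → sumK f ≈ sumK g
  sumK-cong {d} h = sumK≈ {d} (sum-cong-≋ {d} h)

  sumK-0 : ∀ {d} {f : Fin d → Carrier} → (∀ i → f i ≈ 0#) → sumK f ≈ 0#
  sumK-0 {d} h = trans (sumK-cong {d} h) (trans (reflexive (sumK≡sum {d} (λ _ → 0#))) (sum-replicate-zero d))

  sumK-neg : ∀ {d} (f : Fin d → Carrier) → sumK (λ i → - f i) ≈ - sumK f
  sumK-neg {zero}  f = sym ε⁻¹≈ε
  sumK-neg {suc d} f = trans (+-congˡ (sumK-neg (f ∘ Fin.suc))) (⁻¹-∙-comm _ _)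

  sumK-*ˡ : ∀ {d} a (f : Fin d → Carrier) → sumK (λ i → a * f i) ≈ a * sumK f
  sumK-*ˡ a f = trans (reflexive (sumK≡sum (λ i → a * f i)))
    (trans (sym (*-distribˡ-sum a f)) (*-congˡ (reflexive (P.sym (sumK≡sum f)))))

  sumK-*ʳ : ∀ {d} a (f : Fin d → Carrier) → sumK (λ i → f i * a) ≈ sumK f * a
  sumK-*ʳ a f = trans (reflexive (sumK≡sum (λ i → f i * a)))
    (trans (sym (*-distribʳ-sum a f)) (*-congʳ (reflexive (P.sym (sumK≡sum f)))))

  sumK-+ : ∀ {d} (f g : Fin d → Carrier) → sumK (λ i → f i + g i) ≈ sumK f + sumK g
  sumK-+ f g = trans (reflexive (sumK≡sum (λ i → f i + g i)))
    (trans (∑-distrib-+ f g) (sym (+-cong (reflexive (sumK≡sum f)) (reflexive (sumK≡sum g)))))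

  sumK-swap : ∀ {d e} (f : Fin d → Fin e → Carrier) →
    sumK (λ i → sumK (λ j → f i j)) ≈ sumK (λ j → sumK (λ i → f i j))
  sumK-swap {d} {e} f = begin
    sumK (λ i → sumK (f i))           ≈⟨ reflexive (sumK≡sum {d} _) ⟩
    sum (λ i → sumK (f i))            ≈⟨ sum-cong-≋ {d} (λ i → reflexive (sumK≡sum {e} (f i))) ⟩
    sum (λ i → sum (f i))             ≈⟨ ∑-comm f ⟩
    sum (λ j → sum (λ i → f i j))     ≈⟨ sum-cong-≋ {e} (λ j → reflexive (P.sym (sumK≡sum {d} _))) ⟩
    sum (λ j → sumK (λ i → f i j))    ≈⟨ reflexive (P.sym (sumK≡sum {e} _)) ⟩
    sumK (λ j → sumK (λ i → f i j))   ∎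

  δ : ∀ {d} → Fin d → Fin d → Carrier
  δ Fin.zero    Fin.zero    = 1#
  δ Fin.zero    (Fin.suc j) = 0#
  δ (Fin.suc i) Fin.zero    = 0#
  δ (Fin.suc i) (Fin.suc j) = δ i j

  δ-diag : ∀ {d} (i : Fin d) → δ i i ≈ 1#
  δ-diag Fin.zero    = refl
  δ-diag (Fin.suc i) = δ-diag i

  δ-off : ∀ {d} (i j : Fin d) → ¬ i P.≡ j → δ i j ≈ 0#
  δ-off Fin.zero    Fin.zero    i≢j = ⊥-elim (i≢j P.refl)
  δ-off Fin.zero    (Fin.suc j) i≢j = refl
  δ-off (Fin.suc i) Fin.zero    i≢j = refl
  δ-off (Fin.suc i) (Fin.suc j) i≢j = δ-off i j (i≢j ∘ P.cong Fin.suc)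

  δ-injective : ∀ {d d'} (f : Fin d' → Fin d) → (∀ i j → f i P.≡ f j → i P.≡ j) →
    ∀ i j → δ (f j) (f i) ≈ δ j i
  δ-injective f inj i j with j FinP.≟ i
  ... | yes P.refl = trans (δ-diag (f j)) (sym (δ-diag j))
  ... | no  j≢i    = trans (δ-off (f j) (f i) (j≢i ∘ inj j i)) (sym (δ-off j i j≢i))

  sumK-δʳ : ∀ {d} (f : Fin d → Carrier) j → sumK (λ i → f i * δ j i) ≈ f j
  sumK-δʳ {suc d} f Fin.zero =
    trans (+-cong (*-identityʳ _) (sumK-0 {d} (λ i → zeroʳ _))) (+-identityʳ _)
  sumK-δʳ {suc d} f (Fin.suc j) =
    trans (+-cong (zeroʳ _) (sumK-δʳ (f ∘ Fin.suc) j)) (+-identityˡ _)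

  sumK-δˡ : ∀ {d} (f : Fin d → Carrier) j → sumK (λ i → δ j i * f i) ≈ f j
  sumK-δˡ {suc d} f Fin.zero =
    trans (+-cong (*-identityˡ _) (sumK-0 {d} (λ i → zeroˡ _))) (+-identityʳ _)
  sumK-δˡ {suc d} f (Fin.suc j) =
    trans (+-cong (zeroˡ _) (sumK-δˡ (f ∘ Fin.suc) j)) (+-identityˡ _)

  mem-basis : ∀ {m d} (b : Fin d → Vect m) j → b j ∈⟨ b ⟩
  mem-basis b j = δ j , λ k → sym (sumK-δʳ (λ i → b i k) j)

  lc-compose : ∀ {m d e} (b : Fin d → Vect m) (w : Fin e → Vect m) (C : Fin d → Fin e → Carrier) →
    (∀ i → b i ≈ᵥ lc w (C i)) → ∀ γ → lc b γ ≈ᵥ lc w (λ j → sumK (λ i → C i j * γ i))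
  lc-compose {d = d} {e} b w C h γ k = begin
    sumK (λ i → b i k * γ i)                            ≈⟨ sumK-cong {d} (λ i → *-congʳ (h i k)) ⟩
    sumK (λ i → sumK (λ j → w j k * C i j) * γ i)       ≈⟨ sumK-cong {d} (λ i → sym (sumK-*ʳ {e} (γ i) _)) ⟩
    sumK (λ i → sumK (λ j → (w j k * C i j) * γ i))     ≈⟨ sumK-cong {d} (λ i → sumK-cong {e} (λ j → *-assoc _ _ _)) ⟩
    sumK (λ i → sumK (λ j → w j k * (C i j * γ i)))     ≈⟨ sumK-swap {d} {e} _ ⟩
    sumK (λ j → sumK (λ i → w j k * (C i j * γ i)))     ≈⟨ sumK-cong {e} (λ j → sumK-*ˡ {d} _ _) ⟩
    sumK (λ j → w j k * sumK (λ i → C i j * γ i))       ∎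

  span-trans : ∀ {m d e} (b : Fin d → Vect m) (w : Fin e → Vect m) →
    (∀ i → b i ∈⟨ w ⟩) → ∀ v → v ∈⟨ b ⟩ → v ∈⟨ w ⟩
  span-trans b w h v (γ , v≈) = _ , λ k →
    trans (v≈ k) (lc-compose b w (λ i → proj₁ (h i)) (λ i → proj₂ (h i)) γ k)

  ⊆-intro : ∀ {m d e} (X : Sub m d) (Y : Sub m e) → (∀ i → basis X i ∈ Y) → X ⊆ Y
  ⊆-intro X Y = span-trans (basis X) (basis Y)

  ⊆-refl : ∀ {m d} (X : Sub m d) → X ⊆ X
  ⊆-refl X v v∈X = v∈X

  OnlyTrivialSolution : ∀ {d e} → (Fin d → Fin e → Carrier) → Set (c ⊔ ℓ)
  OnlyTrivialSolution {d} {e} A =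
    ∀ (γ : Fin e → Carrier) → (∀ k → sumK (λ i → A k i * γ i) ≈ 0#) → ∀ i → γ i ≈ 0#

  -- Solving the pivot row a γ₀ + S = 0 by γ₀ = -(a⁻¹ S).
  pivot-row : ∀ a a⁻¹ S → a * a⁻¹ ≈ 1# → a * (- (a⁻¹ * S)) + S ≈ 0#
  pivot-row a a⁻¹ S inv = begin
    a * (- (a⁻¹ * S)) + S  ≈⟨ +-congʳ (sym (-‿distribʳ-* _ _)) ⟩
    - (a * (a⁻¹ * S)) + S  ≈⟨ +-congʳ (-‿cong (sym (*-assoc _ _ _))) ⟩
    - ((a * a⁻¹) * S) + S  ≈⟨ +-congʳ (-‿cong (trans (*-congʳ inv) (*-identityˡ S))) ⟩
    - S + S                ≈⟨ -‿inverseˡ S ⟩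
    0#                     ∎

  -- A row B - A·a⁻¹·C of the eliminated system vanishing on γ' means the
  -- original row (A, B) vanishes on (-(a⁻¹ Σ C γ'), γ').
  eliminated-row : ∀ {e} A a⁻¹ (B C γ' : Fin e → Carrier) →
    sumK (λ i → (B i - A * (a⁻¹ * C i)) * γ' i) ≈ 0# →
    A * (- (a⁻¹ * sumK (λ i → C i * γ' i))) + sumK (λ i → B i * γ' i) ≈ 0#
  eliminated-row {e} A a⁻¹ B C γ' h = begin
    A * (- (a⁻¹ * S)) + ∑ B           ≈⟨ +-comm _ _ ⟩
    ∑ B + A * (- (a⁻¹ * S))           ≈⟨ +-congˡ (sym (-‿distribʳ-* _ _)) ⟩
    ∑ B - A * (a⁻¹ * S)               ≈⟨ sym expand ⟩
    sumK (λ i → (B i - A * (a⁻¹ * C i)) * γ' i) ≈⟨ h ⟩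
    0#                                ∎
    where
    S : Carrier
    S = sumK (λ i → C i * γ' i)
    ∑ : (Fin e → Carrier) → Carrier
    ∑ F = sumK (λ i → F i * γ' i)
    expand : sumK (λ i → (B i - A * (a⁻¹ * C i)) * γ' i) ≈ ∑ B - A * (a⁻¹ * S)
    expand = begin
      sumK (λ i → (B i - A * (a⁻¹ * C i)) * γ' i)
        ≈⟨ sumK-cong {e} (λ i → distribʳ _ _ _) ⟩
      sumK (λ i → B i * γ' i + (- (A * (a⁻¹ * C i))) * γ' i)
        ≈⟨ sumK-+ {e} _ _ ⟩
      ∑ B + sumK (λ i → (- (A * (a⁻¹ * C i))) * γ' i)
        ≈⟨ +-congˡ (sumK-cong {e} (λ i → trans (sym (-‿distribˡ-* _ _))
             (-‿cong (trans (*-assoc _ _ _) (*-congˡ (*-assoc _ _ _)))))) ⟩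
      ∑ B + sumK (λ i → - (A * (a⁻¹ * (C i * γ' i))))
        ≈⟨ +-congˡ (trans (sumK-neg {e} _) (-‿cong (trans (sumK-*ˡ {e} A _) (*-congˡ (sumK-*ˡ {e} a⁻¹ _))))) ⟩
      ∑ B - A * (a⁻¹ * S) ∎

  -- Gaussian elimination step: eliminating the first unknown with a pivot in
  -- row j preserves "only the trivial solution".
  eliminate : ∀ {d e} (A : Fin (suc d) → Fin (suc e) → Carrier) (j : Fin (suc d)) (a⁻¹ : Carrier) →
    A j Fin.zero * a⁻¹ ≈ 1# → OnlyTrivialSolution A →
    OnlyTrivialSolution (λ k i → A (punchIn j k) (Fin.suc i)
                                 - A (punchIn j k) Fin.zero * (a⁻¹ * A j (Fin.suc i)))
  eliminate {d} {e} A j a⁻¹ inv trivial γ' solves' i = trivial γ solves (Fin.suc i)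
    where
    γ : Fin (suc e) → Carrier
    γ = cons (- (a⁻¹ * sumK (λ i → A j (Fin.suc i) * γ' i))) γ'
    row : ∀ k → Dec (j P.≡ k) → sumK (λ i → A k i * γ i) ≈ 0#
    row k (yes P.refl) = pivot-row (A j Fin.zero) a⁻¹ _ inv
    row k (no j≢k)     = P.subst (λ k → sumK (λ i → A k i * γ i) ≈ 0#) (FinP.punchIn-punchOut j≢k)
      (eliminated-row (A (punchIn j k') Fin.zero) a⁻¹ (λ i → A (punchIn j k') (Fin.suc i))
                      (λ i → A j (Fin.suc i)) γ' (solves' k'))
      where
      k' : Fin d
      k' = punchOut j≢k
    solves : ∀ k → sumK (λ i → A k i * γ i) ≈ 0#
    solves k = row k (j FinP.≟ k)

  zero-column : ∀ {d e} (A : Fin d → Fin (suc e) → Carrier) →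
    (∀ k → A k Fin.zero ≈ 0#) → ¬ OnlyTrivialSolution A
  zero-column {d} {e} A zero-col trivial = 1≉0 (trivial γ solves Fin.zero)
    where
    γ : Fin (suc e) → Carrier
    γ = cons 1# (λ _ → 0#)
    solves : ∀ k → sumK (λ i → A k i * γ i) ≈ 0#
    solves k = trans (+-cong (trans (*-identityʳ _) (zero-col k)) (sumK-0 {e} (λ i → zeroʳ _)))
                     (+-identityˡ 0#)

  underdetermined : ∀ d e → d < e → (A : Fin d → Fin e → Carrier) → ¬ OnlyTrivialSolution A
  underdetermined zero    (suc e) _ A trivial = 1≉0 (trivial (λ _ → 1#) (λ ()) Fin.zero)
  underdetermined (suc d) (suc e) (s≤s d<e) A trivial =
    all-or-counterexample (λ k → A k Fin.zero ≈ 0#) λ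
      { (inj₁ zero-col)     → zero-column A zero-col trivial
      ; (inj₂ (j , a≉0)) → let (a⁻¹ , inv , _) = inverse _ a≉0 in
          underdetermined d e d<e _ (eliminate A j a⁻¹ inv trivial) }

  steinitz : ∀ {m d e} (u : Fin e → Vect m) → LinIndep u → (w : Fin d → Vect m) →
    (∀ i → u i ∈⟨ w ⟩) → ¬ d < e
  steinitz {m} {d} {e} u indep w u∈w d<e =
    underdetermined d e d<e (λ j i → C i j) λ γ solves → indep γ λ k →
      trans (lc-compose u w C (λ i → proj₂ (u∈w i)) γ k)
            (sumK-0 {d} (λ j → trans (*-congˡ (solves j)) (zeroʳ _)))
    where
    C : Fin e → Fin d → Carrier
    C i = proj₁ (u∈w i)

  ⊆-dim : ∀ {m d e} (X : Sub m e) (Y : Sub m d) → X ⊆ Y → ¬ d < e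
  ⊆-dim X Y X⊆Y = steinitz (basis X) (indep X) (basis Y) (λ i → X⊆Y _ (mem-basis (basis X) i))

  zero-span : ∀ {m d} (b : Fin d → Vect m) (j : Fin m) → (∀ i → b i j ≈ 0#) →
    ∀ v → v ∈⟨ b ⟩ → v j ≈ 0#
  zero-span {d = d} b j h v (γ , v≈) =
    trans (v≈ j) (sumK-0 {d} (λ i → trans (*-congʳ (h i)) (zeroˡ _)))

  rel-span : ∀ {m d} (b : Fin d → Vect m) (j j' : Fin m) β → (∀ i → b i j' ≈ β * b i j) →
    ∀ v → v ∈⟨ b ⟩ → v j' ≈ β * v j
  rel-span {d = d} b j j' β h v (γ , v≈) = begin
    v j'                         ≈⟨ v≈ j' ⟩
    sumK (λ i → b i j' * γ i)    ≈⟨ sumK-cong {d} (λ i → trans (*-congʳ (h i)) (*-assoc _ _ _)) ⟩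
    sumK (λ i → β * (b i j * γ i)) ≈⟨ sumK-*ˡ {d} β _ ⟩
    β * sumK (λ i → b i j * γ i) ≈⟨ *-congˡ (sym (v≈ j)) ⟩
    β * v j                      ∎

  nonzero-basis : ∀ {m d} (b : Fin d → Vect m) → LinIndep b → ∀ j → ¬ (∀ k → b j k ≈ 0#)
  nonzero-basis b indep j zero-vec =
    1≉0 (trans (sym (δ-diag j)) (indep (δ j) (λ k → trans (sumK-δʳ (λ i → b i k) j) (zero-vec k)) j))

  line-lemma : ∀ {m d} (X : Sub m (suc d)) (p : Fin 1 → Vect m) (j : Fin m) → p Fin.zero j ≈ 1# →
    (∀ y → y ∈ X → y ∈⟨ p ⟩) → ¬ (∀ y → y ∈ X → y j ≈ 0#)
  line-lemma {m} X p j pj≈1 X⊆p vanish = nonzero-basis (basis X) (indep X) Fin.zero λ k →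
    trans (y≈ k) (trans (+-identityʳ _) (trans (*-congˡ γ₀≈0) (zeroʳ _)))
    where
    y : Vect m
    y = basis X Fin.zero
    y∈X : y ∈ X
    y∈X = mem-basis (basis X) Fin.zero
    γ : Fin 1 → Carrier
    γ = proj₁ (X⊆p y y∈X)
    y≈ : y ≈ᵥ lc p γ
    y≈ = proj₂ (X⊆p y y∈X)
    γ₀≈0 : γ Fin.zero ≈ 0#
    γ₀≈0 = trans (sym (trans (y≈ j) (trans (+-identityʳ _) (trans (*-congʳ pj≈1) (*-identityˡ _)))))
                 (vanish _ y∈X)

  cancel-nonzero : ∀ β x → ¬ β ≈ 0# → β * x ≈ 0# → x ≈ 0#
  cancel-nonzero β x β≉0 βx≈0 = begin
    x                ≈⟨ sym (*-identityˡ x) ⟩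
    1# * x           ≈⟨ *-congʳ (sym (proj₂ (proj₂ (inverse β β≉0)))) ⟩
    (β⁻¹ * β) * x    ≈⟨ *-assoc _ _ _ ⟩
    β⁻¹ * (β * x)    ≈⟨ *-congˡ βx≈0 ⟩
    β⁻¹ * 0#         ≈⟨ zeroʳ _ ⟩
    0#               ∎
    where
    β⁻¹ : Carrier
    β⁻¹ = proj₁ (inverse β β≉0)

  dim-inter-intro : ∀ {m d e k} (X : Sub m d) (Y : Fin e → Vect m) (b : Fin k → Vect m) → LinIndep b →
    (∀ i → b i ∈ X) → (∀ i → b i ∈⟨ Y ⟩) → (∀ v → v ∈ X → v ∈⟨ Y ⟩ → v ∈⟨ b ⟩) → DimInter X Y k
  dim-inter-intro X Y b indep b⊆X b⊆Y meet = b , indep , λ v →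
    (λ v∈b → span-trans b (basis X) b⊆X v v∈b , span-trans b Y b⊆Y v v∈b) ,
    λ (v∈X , v∈Y) → meet v v∈X v∈Y

  -- Private positions: b i (pos j) = δᵢⱼ, so coordinates read off coefficients.
  PrivPos : ∀ {m d} → (Fin d → Vect m) → Set ℓ
  PrivPos {m} {d} b = Σ (Fin d → Fin m) λ pos → ∀ i j → b i (pos j) ≈ δ j i

  priv-coef : ∀ {m d} (b : Fin d → Vect m) → (pp : PrivPos b) → ∀ v γ → v ≈ᵥ lc b γ →
    ∀ j → v (proj₁ pp j) ≈ γ j
  priv-coef {d = d} b (pos , h) v γ v≈ j =
    trans (v≈ (pos j)) (trans (sumK-cong {d} (λ i → *-congʳ (h i j))) (sumK-δˡ γ j))

  priv-indep : ∀ {m d} (b : Fin d → Vect m) → PrivPos b → LinIndep b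
  priv-indep b pp γ zero-vec j = trans (sym (priv-coef b pp (lc b γ) γ (λ k → refl) j)) (zero-vec (proj₁ pp j))

  priv-reindex : ∀ {m d d'} (b : Fin d → Vect m) (f : Fin d' → Fin d) →
    (∀ i j → f i P.≡ f j → i P.≡ j) → PrivPos b → PrivPos (b ∘ f)
  priv-reindex b f inj (pos , h) = pos ∘ f , λ i j → trans (h (f i) (f j)) (δ-injective f inj i j)

  priv-cons : ∀ {m d} (v : Vect m) (rest : Fin d → Vect m) (p : Fin m) → v p ≈ 1# →
    (∀ i → rest i p ≈ 0#) → (pp : PrivPos rest) → (∀ j → v (proj₁ pp j) ≈ 0#) →
    PrivPos (cons v rest)
  priv-cons v rest p vp≈1 rest-p≈0 (pos , h) v-pos≈0 = cons p pos , λ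
    { Fin.zero    Fin.zero    → vp≈1
    ; Fin.zero    (Fin.suc j) → v-pos≈0 j
    ; (Fin.suc i) Fin.zero    → rest-p≈0 i
    ; (Fin.suc i) (Fin.suc j) → h i j }

  unit-hit : ∀ {m} k (j : Fin m) → toℕ j P.≡ k → unitV k j ≈ 1#
  unit-hit k j e = reflexive (if-true (toℕ j ℕ.≡ᵇ k) (ℕP.≡⇒≡ᵇ (toℕ j) k e))

  unit-miss : ∀ {m} k (j : Fin m) → ¬ toℕ j P.≡ k → unitV k j ≈ 0#
  unit-miss k j ne = reflexive (if-false (toℕ j ℕ.≡ᵇ k) (ne ∘ ℕP.≡ᵇ⇒≡ (toℕ j) k))

  unit-priv : ∀ {m d} (f : Fin d → ℕ) → (∀ k → f k < m) → (∀ i j → f i P.≡ f j → i P.≡ j) →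
    PrivPos (λ k → unitV {m} (f k))
  unit-priv f f<m inj = (λ j → Fin.fromℕ< (f<m j)) , entry
    where
    entry : ∀ i j → unitV (f i) (Fin.fromℕ< (f<m j)) ≈ δ j i
    entry i j with j FinP.≟ i
    ... | yes P.refl = trans (unit-hit (f j) _ (FinP.toℕ-fromℕ< (f<m j))) (sym (δ-diag j))
    ... | no  j≢i    = trans (unit-miss (f i) _ (λ e → j≢i (inj j i (P.trans (P.sym (FinP.toℕ-fromℕ< (f<m j))) e))))
                             (sym (δ-off j i j≢i))

  coord-at : ∀ {m} (v : Vect m) (j : Fin m) {k} → toℕ j P.≡ k → coord v k P.≡ v j
  coord-at v Fin.zero    P.refl = P.refl
  coord-at v (Fin.suc j) P.refl = coord-at (v ∘ Fin.suc) j P.refl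

  coord-zero : ∀ {m} (v : Vect m) k → (∀ j → toℕ j P.≡ k → v j ≈ 0#) → coord v k ≈ 0#
  coord-zero {zero}  v k       h = refl
  coord-zero {suc m} v zero    h = h Fin.zero P.refl
  coord-zero {suc m} v (suc k) h = coord-zero (v ∘ Fin.suc) k (λ j e → h (Fin.suc j) (P.cong suc e))

  Obeys : ∀ {m d} → Sub m d → Fin m → Fin m → Carrier → Set (c ⊔ ℓ)
  Obeys X j j' β = ∀ y → y ∈ X → y j' ≈ β * y j

  obeys-intro : ∀ {m d} (X : Sub m d) j j' β → (∀ i → basis X i j' ≈ β * basis X i j) → Obeys X j j' β
  obeys-intro X j j' β = rel-span (basis X) j j' β

  obeys-⊆ : ∀ {m d e} (X : Sub m d) (Y : Sub m e) j j' β → X ⊆ Y → Obeys Y j j' β → Obeys X j j' β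
  obeys-⊆ X Y j j' β X⊆Y obeys y y∈X = obeys y (X⊆Y y y∈X)

-- Rationality over a sub-division ring K0 of K.
module Rationality {c ℓ ℓ₀ : Level} (K : DivisionRing c ℓ) (K0 : DivisionRing.Carrier K → Set ℓ₀)
                   (sub : IsSubDivisionRing K K0) where
  open LinearAlgebra K public
  open IsSubDivisionRing sub public

  irrational-neg : ∀ {β} → ¬ K0 β → ¬ K0 (- β)
  irrational-neg β∉K0 -β∈K0 = β∉K0 (resp (⁻¹-involutive _) (neg-cl -β∈K0))

  irrational-nonzero : ∀ {β} → ¬ K0 β → ¬ β ≈ 0#
  irrational-nonzero β∉K0 β≈0 = β∉K0 (resp (sym β≈0) 0∈)

  -- If y = β x with x, y ∈ K0 and β ∉ K0, then x = 0 (else β = y x⁻¹ ∈ K0).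
  irrational-ratio : ∀ {β} → ¬ K0 β → ∀ x y → K0 x → K0 y → y ≈ β * x → DN (x ≈ 0#)
  irrational-ratio {β} β∉K0 x y x∈K0 y∈K0 y≈βx x≉0 =
    β∉K0 (resp yx⁻¹≈β (*-cl y∈K0 (inv-cl x∈K0 xx⁻¹≈1 x⁻¹x≈1)))
    where
    x⁻¹ : Carrier
    x⁻¹ = proj₁ (inverse x x≉0)
    xx⁻¹≈1 : x * x⁻¹ ≈ 1#
    xx⁻¹≈1 = proj₁ (proj₂ (inverse x x≉0))
    x⁻¹x≈1 : x⁻¹ * x ≈ 1#
    x⁻¹x≈1 = proj₂ (proj₂ (inverse x x≉0))
    yx⁻¹≈β : y * x⁻¹ ≈ β
    yx⁻¹≈β = begin
      y * x⁻¹        ≈⟨ *-congʳ y≈βx ⟩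
      (β * x) * x⁻¹  ≈⟨ *-assoc β x x⁻¹ ⟩
      β * (x * x⁻¹)  ≈⟨ *-congˡ xx⁻¹≈1 ⟩
      β * 1#         ≈⟨ *-identityʳ β ⟩
      β              ∎

  -- Key lemma: a K0-rational subspace obeying y_{j'} = β y_j with β ∉ K0
  -- lies in the hyperplane y_j = 0 (apply irrational-ratio to a rational basis).
  rational-obeys-vanishes : ∀ {m d β} (X : Sub m d) → RatSub K0 X → ¬ K0 β → ∀ j j' →
    Obeys X j j' β → DN (∀ y → y ∈ X → y j ≈ 0#)
  rational-obeys-vanishes X (b , _ , b-rat , b-spans) β∉K0 j j' obeys =
    dn-all (λ i → b i j ≈ 0#)
      (λ i → irrational-ratio β∉K0 _ _ (b-rat i j) (b-rat i j')
               (obeys (b i) (proj₁ (b-spans (b i)) (mem-basis b i))))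
    >>= λ b-vanish → return λ y y∈X → zero-span b j b-vanish y (proj₂ (b-spans y) y∈X)

  rational-obeys-excludes : ∀ {m d β} (X : Sub m d) → RatSub K0 X → ¬ K0 β → ∀ j j' →
    Obeys X j j' β → ∀ v → v ∈ X → v j ≈ 1# → ⊥
  rational-obeys-excludes X rat β∉K0 j j' obeys v v∈X vj≈1 =
    rational-obeys-vanishes X rat β∉K0 j j' obeys λ vanish → 1≉0 (trans (sym vj≈1) (vanish v v∈X))

  -- A rational subspace X, incident with a larger subspace H obeying an
  -- irrational relation, cannot be incident with a line ⟨p⟩ where p_j = 1:
  -- X ⊆ H forces X ⊆ {y_j = 0}, which neither contains p nor meets ⟨p⟩.
  rational-between : ∀ {m d e β} (X : Sub m (suc d)) → RatSub K0 X → ¬ K0 β →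
    (H : Sub m e) → ∀ j j' → Obeys H j j' β → suc d < e → SymInc X H →
    (P : Sub m 1) → basis P Fin.zero j ≈ 1# → SymInc X P → ⊥
  rational-between X rat β∉K0 H j j' obeys d<e (inj₂ H⊆X) P pj≈1 X~P = ⊆-dim H X H⊆X d<e
  rational-between X rat β∉K0 H j j' obeys d<e (inj₁ X⊆H) P pj≈1 X~P =
    rational-obeys-vanishes X rat β∉K0 j j' (obeys-⊆ X H j j' _ X⊆H obeys) (refute X~P)
    where
    p∈P : basis P Fin.zero ∈ P
    p∈P = mem-basis (basis P) Fin.zero
    refute : SymInc X P → ¬ (∀ y → y ∈ X → y j ≈ 0#)
    refute (inj₁ X⊆P) vanish = line-lemma X (basis P) j pj≈1 X⊆P vanish
    refute (inj₂ P⊆X) vanish = 1≉0 (trans (sym pj≈1) (vanish _ (P⊆X _ p∈P)))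

-- Positions are 0-indexed and e_k = unitV k.  With v = e₀ + e₁α (α ∉ K0) take the
-- full flag ⟨v⟩ ⊂ ⟨v, e₂⟩ ⊂ … ⊂ ⟨v, e₂, …, e_n⟩ in K^(n+1); all its elements obey
-- y₁ = α y₀ and contain v, whose coordinate y₀ is 1.  Any n ≥ 1 works.
module FlagA {c ℓ ℓ₀ : Level} (K : DivisionRing c ℓ) (K0 : DivisionRing.Carrier K → Set ℓ₀)
             (sub : IsSubDivisionRing K K0) (α : DivisionRing.Carrier K) (α∉K0 : ¬ K0 α)
             (n' : ℕ) where
  open Rationality K K0 sub

  n : ℕ
  n = suc n'

  p₀ p₁ : Fin (suc n)
  p₀ = Fin.zero
  p₁ = Fin.suc Fin.zero

  v : Vect (suc n)
  v j = unitV 0 j + unitV 1 j * α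

  v-p₀ : v p₀ ≈ 1#
  v-p₀ = trans (+-congˡ (zeroˡ α)) (+-identityʳ 1#)

  v-high : ∀ (j : Fin (suc n)) → 2 ≤ toℕ j → v j ≈ 0#
  v-high j 2≤j = trans (+-cong (unit-miss 0 j (λ e → ℕP.<⇒≢ (ℕP.<-trans (s≤s z≤n) 2≤j) (P.sym e)))
                               (*-congʳ (unit-miss 1 j (λ e → ℕP.<⇒≢ 2≤j (P.sym e)))))
                       (trans (+-congˡ (zeroˡ α)) (+-identityʳ 0#))

  generator : Fin n → Vect (suc n)
  generator = cons v (λ k → unitV (2 ℕ.+ toℕ k))

  generator-priv : PrivPos generator
  generator-priv = priv-cons v _ p₀ v-p₀ (λ i → refl) units-priv λ j →
    v-high _ (P.subst (2 ≤_) (P.sym (FinP.toℕ-fromℕ< (unit<n j))) (s≤s (s≤s z≤n)))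
    where
    unit<n : ∀ k → 2 ℕ.+ toℕ k < suc n
    unit<n k = s≤s (s≤s (FinP.toℕ<n k))
    units-priv : PrivPos (λ k → unitV {suc n} (2 ℕ.+ toℕ k))
    units-priv = unit-priv (λ k → 2 ℕ.+ toℕ k) unit<n
                   (λ i j e → FinP.toℕ-injective (ℕP.suc-injective (ℕP.suc-injective e)))

  generator-obeys : ∀ i → generator i p₁ ≈ α * generator i p₀
  generator-obeys Fin.zero    = trans (+-identityˡ _) (trans (*-identityˡ α) (sym (trans (*-congˡ v-p₀) (*-identityʳ α))))
  generator-obeys (Fin.suc k) = sym (zeroʳ α)

  -- the element of type t + 1: the span of the first t + 1 generators
  element : (t : Fin n) → Sub (suc n) (suc (toℕ t))
  element t = record
    { basis = generator ∘ prefix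
    ; indep = priv-indep (generator ∘ prefix) (priv-reindex generator prefix (FinP.inject≤-injective _ _) generator-priv) }
    where
    prefix : Fin (suc (toℕ t)) → Fin n
    prefix i = Fin.inject≤ i (FinP.toℕ<n t)

  v∈element : ∀ t → v ∈ element t
  v∈element t = mem-basis (basis (element t)) Fin.zero

  element-obeys : ∀ t → Obeys (element t) p₀ p₁ α
  element-obeys t = obeys-intro (element t) p₀ p₁ α (λ i → generator-obeys (Fin.inject≤ i (FinP.toℕ<n t)))

  element-mono : ∀ s t → toℕ s ≤ toℕ t → element s ⊆ element t
  element-mono s t s≤t = ⊆-intro (element s) (element t) λ i →
    P.subst (_∈ element t) (P.cong generator (FinP.inject≤-idempotent i _ _ _))
      (mem-basis (basis (element t)) (Fin.inject≤ i (s≤s s≤t)))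

  flag : Point (A-building K K0 n) (J-A-1n n)
  flag = (λ t _ → element t) , λ s t _ _ → incident s t (ℕP.≤-total (toℕ s) (toℕ t))
    where
    incident : ∀ s t → (toℕ s ≤ toℕ t) ⊎ (toℕ t ≤ toℕ s) → SymInc (element s) (element t)
    incident s t (inj₁ s≤t) = inj₁ (element-mono s t s≤t)
    incident s t (inj₂ t≤s) = inj₂ (element-mono t s t≤s)

  -- the hyperplane, of type n ∈ J
  last : Fin n
  last = Fin.fromℕ n'

  in-J : ∀ t → toℕ t P.≡ n' → T (J-A-1n n t)
  in-J t t≡n' = Equivalence.from BoolP.T-∨ (inj₂ (ℕP.≡⇒≡ᵇ (toℕ t) n' t≡n'))

  last∈J : T (J-A-1n n last)
  last∈J = in-J last (FinP.toℕ-fromℕ n')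

  outside-J : ∀ t → J-A-1n n t P.≡ false → suc (toℕ t) < suc (toℕ last)
  outside-J t t∉J rewrite FinP.toℕ-fromℕ n' =
    s≤s (ℕP.≤∧≢⇒< (ℕP.≤-pred (FinP.toℕ<n t)) (λ t≡n' → P.subst T t∉J (in-J t t≡n')))

  -- No element of the flag is rational; a rational element of a type t ∉ J
  -- would be incident with the hyperplane (of larger dimension) and with ⟨v⟩.
  not-nearly-rational : NotAllNearlyRational (A-building K K0 n) (J-A-1n n)
  not-nearly-rational all with all flag
  ... | inj₁ (t , _ , rat) =
    rational-obeys-excludes (element t) rat α∉K0 p₀ p₁ (element-obeys t) v (v∈element t) v-p₀
  ... | inj₂ (t , x , (t∉J , _) , rat , incident) =
    rational-between x rat α∉K0 (element last) p₀ p₁ (element-obeys last) (outside-J t t∉J)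
      (incident last last∈J) (element Fin.zero) v-p₀ (incident Fin.zero _)

-- Paths in a diagram with one node removed, for a symmetric adjacency.
module Paths {a r : Level} (B : Building a r)
             (adj-sym : ∀ {x y} → Building.adj B x y → Building.adj B y x) where
  open Building B using (Ty)

  start≢ : ∀ {t x y} → ConnWithout B t x y → ¬ x P.≡ t
  start≢ (here x≢t)     = x≢t
  start≢ (step x≢t _ _) = x≢t

  _++_ : ∀ {t x y z} → ConnWithout B t x y → ConnWithout B t y z → ConnWithout B t x z
  here _       ++ q = q
  step x≢t a p ++ q = step x≢t a (p ++ q)

  reverse : ∀ {t x y} → ConnWithout B t x y → ConnWithout B t y x
  reverse (here x≢t)     = here x≢t
  reverse (step x≢t a p) = reverse p ++ step (start≢ p) (adj-sym a) (here x≢t)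

  connected-via-hub : ∀ {t hub} (J : Ty → Bool) → (∀ x → T (J x) → ConnWithout B t x hub) →
    ∀ x y → T (J x) → T (J y) → ConnWithout B t x y
  connected-via-hub J to-hub x y x∈J y∈J = to-hub x x∈J ++ reverse (to-hub y y∈J)

-- With u = e₀ + e₃α, w = e₂ − e₁α and L = ⟨u, w, e₆, e₈, …, e_{2n−2}⟩ take
-- M⁺ = L + ⟨e₄⟩, M⁻ = L + ⟨e₅⟩ and the point ⟨u⟩.  All of them obey
-- y₃ = α y₀ and y₁ = −α y₂, which makes them totally singular and irrational.
module FlagD {c ℓ ℓ₀ : Level} (K : DivisionRing c ℓ) (K0 : DivisionRing.Carrier K → Set ℓ₀)
             (sub : IsSubDivisionRing K K0) (α : DivisionRing.Carrier K) (α∉K0 : ¬ K0 α)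
             (comm : IsCommutative K) (m : ℕ) where
  open Rationality K K0 sub

  n : ℕ
  n = suc (suc (suc m))

  W : ℕ
  W = 2 ℕ.* n

  6≤W : 6 ≤ W
  6≤W = ℕP.*-monoʳ-≤ 2 (s≤s (s≤s (s≤s z≤n)))

  pos : (k : ℕ) → {T (k ℕ.<ᵇ 6)} → Fin W
  pos k {k<6} = Fin.fromℕ< (ℕP.<-≤-trans (ℕP.<ᵇ⇒< k 6 k<6) 6≤W)

  toℕ-pos : ∀ k {k<6} → toℕ (pos k {k<6}) P.≡ k
  toℕ-pos k = FinP.toℕ-fromℕ< _

  pos<4 : ∀ k {k<6} {k<4 : T (k ℕ.<ᵇ 4)} → toℕ (pos k {k<6}) < 4
  pos<4 k {k<6} {k<4} = P.subst (_< 4) (P.sym (toℕ-pos k {k<6})) (ℕP.<ᵇ⇒< k 4 k<4)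

  p₀ p₁ p₂ p₃ : Fin W
  p₀ = pos 0
  p₁ = pos 1
  p₂ = pos 2
  p₃ = pos 3

  -- u, w live on positions 0–3 and the remaining generators on positions ≥ 4.
  ≢-low : ∀ {a x} → a < 4 → 4 ≤ x → ¬ x P.≡ a
  ≢-low a<4 4≤x x≡a = ℕP.<⇒≢ (ℕP.<-≤-trans a<4 4≤x) (P.sym x≡a)

  pair : ℕ → ℕ → Carrier → Vect W
  pair a b β j = unitV a j + unitV b j * β

  -- At a position of known number the two tests in `pair` compute.
  pair-at : ∀ a b β {j : Fin W} {i} → toℕ j P.≡ i →
    pair a b β j ≈ (if i ℕ.≡ᵇ a then 1# else 0#) + (if i ℕ.≡ᵇ b then 1# else 0#) * β
  pair-at a b β e = reflexive (P.cong (λ i → (if i ℕ.≡ᵇ a then 1# else 0#) + (if i ℕ.≡ᵇ b then 1# else 0#) * β) e)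

  pair-high : ∀ a b β (j : Fin W) → a < 4 → b < 4 → 4 ≤ toℕ j → pair a b β j ≈ 0#
  pair-high a b β j a<4 b<4 4≤j =
    trans (+-cong (unit-miss a j (≢-low a<4 4≤j)) (*-congʳ (unit-miss b j (≢-low b<4 4≤j))))
          (trans (+-identityˡ _) (zeroˡ β))

  unit-low : ∀ {a} (j : Fin W) → 4 ≤ a → toℕ j < 4 → unitV a j ≈ 0#
  unit-low {a} j 4≤a j<4 = unit-miss a j (λ j≡a → ≢-low j<4 4≤a (P.sym j≡a))

  u w : Vect W
  u = pair 0 3 α
  w = pair 2 1 (- α)

  u-p₀ : u p₀ ≈ 1#
  u-p₀ = trans (pair-at 0 3 α (toℕ-pos 0)) (trans (+-congˡ (zeroˡ α)) (+-identityʳ 1#))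

  u-p₂ : u p₂ ≈ 0#
  u-p₂ = trans (pair-at 0 3 α (toℕ-pos 2)) (trans (+-identityˡ _) (zeroˡ α))

  w-p₂ : w p₂ ≈ 1#
  w-p₂ = trans (pair-at 2 1 (- α) (toℕ-pos 2)) (trans (+-congˡ (zeroˡ _)) (+-identityʳ 1#))

  w-p₀ : w p₀ ≈ 0#
  w-p₀ = trans (pair-at 2 1 (- α) (toℕ-pos 0)) (trans (+-identityˡ _) (zeroˡ _))

  u-high : ∀ (j : Fin W) → 4 ≤ toℕ j → u j ≈ 0#
  u-high j = pair-high 0 3 α j (s≤s z≤n) (s≤s (s≤s (s≤s (s≤s z≤n))))

  w-high : ∀ (j : Fin W) → 4 ≤ toℕ j → w j ≈ 0#
  w-high j = pair-high 2 1 (- α) j (s≤s (s≤s (s≤s z≤n))) (s≤s (s≤s z≤n))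

  u-obeys₀₃ : u p₃ ≈ α * u p₀
  u-obeys₀₃ = trans (pair-at 0 3 α (toℕ-pos 3))
    (trans (trans (+-identityˡ _) (*-identityˡ α)) (sym (trans (*-congˡ u-p₀) (*-identityʳ α))))

  w-obeys₀₃ : w p₃ ≈ α * w p₀
  w-obeys₀₃ = trans (pair-at 2 1 (- α) (toℕ-pos 3))
    (trans (trans (+-identityˡ _) (zeroˡ _)) (sym (trans (*-congˡ w-p₀) (zeroʳ α))))

  u-obeys₂₁ : u p₁ ≈ (- α) * u p₂
  u-obeys₂₁ = trans (pair-at 0 3 α (toℕ-pos 1))
    (trans (trans (+-identityˡ _) (zeroˡ α)) (sym (trans (*-congˡ u-p₂) (zeroʳ _))))

  w-obeys₂₁ : w p₁ ≈ (- α) * w p₂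
  w-obeys₂₁ = trans (pair-at 2 1 (- α) (toℕ-pos 1))
    (trans (trans (+-identityˡ _) (*-identityˡ _)) (sym (trans (*-congˡ w-p₂) (*-identityʳ _))))

  units : ∀ {d} → (Fin d → ℕ) → Fin d → Vect W
  units f k = unitV (f k)

  gens : ∀ {d} → (Fin d → ℕ) → Fin (suc (suc d)) → Vect W
  gens f = cons u (cons w (units f))

  -- f lists distinct positions ≥ 4 of K^(2n); then gens f is a basis.
  record Admissible {d} (f : Fin d → ℕ) : Set where
    field
      high      : ∀ k → 4 ≤ f k
      bounded   : ∀ k → f k < W
      injective : ∀ i j → f i P.≡ f j → i P.≡ j
  open Admissible

  cons-admissible : ∀ {d} a (f : Fin d → ℕ) → 4 ≤ a → a < W → (∀ k → ¬ f k P.≡ a) →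
    Admissible f → Admissible (cons a f)
  cons-admissible a f 4≤a a<W fresh adm = record
    { high      = λ { Fin.zero → 4≤a ; (Fin.suc k) → high adm k }
    ; bounded   = λ { Fin.zero → a<W ; (Fin.suc k) → bounded adm k }
    ; injective = λ
        { Fin.zero    Fin.zero    _ → P.refl
        ; Fin.zero    (Fin.suc j) e → ⊥-elim (fresh j (P.sym e))
        ; (Fin.suc i) Fin.zero    e → ⊥-elim (fresh i e)
        ; (Fin.suc i) (Fin.suc j) e → P.cong Fin.suc (injective adm i j e) } }

  units-priv : ∀ {d} (f : Fin d → ℕ) → Admissible f → PrivPos (units f)
  units-priv f adm = unit-priv f (bounded adm) (injective adm)

  -- private positions of gens f: p₀ for u, p₂ for w, f k for e_{f k}
  gens-priv : ∀ {d} (f : Fin d → ℕ) → Admissible f → PrivPos (gens f)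
  gens-priv f adm =
    priv-cons u _ p₀ u-p₀ rest-p₀
      (priv-cons w _ p₂ w-p₂ (λ k → unit-low p₂ (high adm k) (pos<4 2)) (units-priv f adm) (w-high _ ∘ unit-pos-high))
      λ { Fin.zero → u-p₂ ; (Fin.suc k) → u-high _ (unit-pos-high k) }
    where
    unit-pos-high : ∀ k → 4 ≤ toℕ (proj₁ (units-priv f adm) k)
    unit-pos-high k = P.subst (4 ≤_) (P.sym (FinP.toℕ-fromℕ< (bounded adm k))) (high adm k)
    rest-p₀ : ∀ i → cons w (units f) i p₀ ≈ 0#
    rest-p₀ Fin.zero    = w-p₀
    rest-p₀ (Fin.suc k) = unit-low p₀ (high adm k) (pos<4 0)

  gens-obeys : ∀ {d} (f : Fin d → ℕ) → Admissible f → ∀ (j j' : Fin W) β → toℕ j < 4 → toℕ j' < 4 →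
    u j' ≈ β * u j → w j' ≈ β * w j → ∀ i → gens f i j' ≈ β * gens f i j
  gens-obeys f adm j j' β j<4 j'<4 u-ok w-ok Fin.zero           = u-ok
  gens-obeys f adm j j' β j<4 j'<4 u-ok w-ok (Fin.suc Fin.zero) = w-ok
  gens-obeys f adm j j' β j<4 j'<4 u-ok w-ok (Fin.suc (Fin.suc k)) =
    trans (unit-low j' (high adm k) j'<4) (sym (trans (*-congˡ (unit-low j (high adm k) j<4)) (zeroʳ β)))

  span : ∀ {d} (f : Fin d → ℕ) → Admissible f → Sub W (suc (suc d))
  span f adm = record { basis = gens f ; indep = priv-indep (gens f) (gens-priv f adm) }

  span-obeys₀₃ : ∀ {d} (f : Fin d → ℕ) (adm : Admissible f) → Obeys (span f adm) p₀ p₃ α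
  span-obeys₀₃ f adm = obeys-intro (span f adm) p₀ p₃ α
    (gens-obeys f adm p₀ p₃ α (pos<4 0) (pos<4 3) u-obeys₀₃ w-obeys₀₃)

  span-obeys₂₁ : ∀ {d} (f : Fin d → ℕ) (adm : Admissible f) → Obeys (span f adm) p₂ p₁ (- α)
  span-obeys₂₁ f adm = obeys-intro (span f adm) p₂ p₁ (- α)
    (gens-obeys f adm p₂ p₁ (- α) (pos<4 2) (pos<4 1) u-obeys₂₁ w-obeys₂₁)

  VanishesAt : Vect W → ℕ → Set ℓ
  VanishesAt v a = ∀ j → toℕ j P.≡ a → v j ≈ 0#

  span-vanishes : ∀ {d} (f : Fin d → ℕ) → ∀ a → 4 ≤ a → (∀ k → ¬ f k P.≡ a) →
    ∀ v → v ∈⟨ gens f ⟩ → VanishesAt v a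
  span-vanishes f a 4≤a f≢a v v∈ j j≡a = zero-span (gens f) j gens-j v v∈
    where
    4≤j : 4 ≤ toℕ j
    4≤j = P.subst (4 ≤_) (P.sym j≡a) 4≤a
    gens-j : ∀ i → gens f i j ≈ 0#
    gens-j Fin.zero              = u-high j 4≤j
    gens-j (Fin.suc Fin.zero)    = w-high j 4≤j
    gens-j (Fin.suc (Fin.suc k)) = unit-miss (f k) j (λ e → f≢a k (P.trans (P.sym e) j≡a))

  -- The coefficients of v ∈ ⟨gens f⟩ on u and w are v's coordinates at p₀ and p₂;
  -- when they vanish, v ∈ ⟨e_{f 0}, …⟩.
  drop-uw : ∀ {d} (f : Fin d → ℕ) → Admissible f → ∀ v → v ∈⟨ gens f ⟩ →
    v p₀ ≈ 0# → v p₂ ≈ 0# → v ∈⟨ units f ⟩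
  drop-uw f adm v (γ , v≈) v₀≈0 v₂≈0 = γ ∘ Fin.suc ∘ Fin.suc , λ k → trans (v≈ k)
    (trans (+-cong (trans (*-congˡ γ₀≈0) (zeroʳ _))
                   (trans (+-congʳ (trans (*-congˡ γ₁≈0) (zeroʳ _))) (+-identityˡ _)))
           (+-identityˡ _))
    where
    γ₀≈0 : γ Fin.zero ≈ 0#
    γ₀≈0 = trans (sym (priv-coef (gens f) (gens-priv f adm) v γ v≈ Fin.zero)) v₀≈0
    γ₁≈0 : γ (Fin.suc Fin.zero) ≈ 0#
    γ₁≈0 = trans (sym (priv-coef (gens f) (gens-priv f adm) v γ v≈ (Fin.suc Fin.zero))) v₂≈0

  drop-first : ∀ {d} a (f : Fin d → ℕ) → Admissible (cons a f) → ∀ v → v ∈⟨ gens (cons a f) ⟩ →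
    VanishesAt v a → v ∈⟨ gens f ⟩
  drop-first a f adm v (γ , v≈) v-a≈0 =
    cons (γ Fin.zero) (cons (γ (Fin.suc Fin.zero)) (γ ∘ Fin.suc ∘ Fin.suc ∘ Fin.suc)) , λ k →
    trans (v≈ k) (+-congˡ (+-congˡ (trans (+-congʳ (trans (*-congˡ γ₂≈0) (zeroʳ _))) (+-identityˡ _))))
    where
    γ₂≈0 : γ (Fin.suc (Fin.suc Fin.zero)) ≈ 0#
    γ₂≈0 = trans (sym (priv-coef (gens (cons a f)) (gens-priv (cons a f) adm) v γ v≈ (Fin.suc (Fin.suc Fin.zero))))
                 (v-a≈0 _ (FinP.toℕ-fromℕ< (bounded adm Fin.zero)))

  -- On span f the relations turn y₃ = 0, y₁ = 0 into y₀ = 0, y₂ = 0.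
  odd-low-vanish : ∀ {d} (f : Fin d → ℕ) (adm : Admissible f) → ∀ v → v ∈⟨ gens f ⟩ →
    VanishesAt v 1 → VanishesAt v 3 → v ∈⟨ units f ⟩
  odd-low-vanish f adm v v∈ v-1≈0 v-3≈0 = drop-uw f adm v v∈
    (cancel-nonzero α _ (irrational-nonzero α∉K0)
       (trans (sym (span-obeys₀₃ f adm v v∈)) (v-3≈0 p₃ (toℕ-pos 3))))
    (cancel-nonzero (- α) _ (irrational-nonzero (irrational-neg α∉K0))
       (trans (sym (span-obeys₂₁ f adm v v∈)) (v-1≈0 p₁ (toℕ-pos 1))))

  P₊-odd : ∀ a v → v ∈⟨ P₊ K n ⟩ → VanishesAt v (suc (2 ℕ.* a))
  P₊-odd a v v∈ j j≡ = zero-span (P₊ K n) j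
    (λ i → unit-miss (2 ℕ.* toℕ i) j (λ e → ℕP.even≢odd (toℕ i) a (P.trans (P.sym e) j≡))) v v∈

  -- Total singularity: q(y) = y₀y₁ + y₂y₃ + Σ_{a ≥ 2} y_{2a} y_{2a+1}; the relations kill
  -- the first two terms (K commutative), and each later term once f avoids a
  -- coordinate of the hyperbolic pair (2a, 2a + 1).
  Sparse : ∀ {d} → (Fin d → ℕ) → Set
  Sparse f = ∀ a → 2 ≤ a → (∀ k → ¬ f k P.≡ 2 ℕ.* a) ⊎ (∀ k → ¬ f k P.≡ suc (2 ℕ.* a))

  head-cancels : ∀ y₀ y₂ → y₀ * ((- α) * y₂) + y₂ * (α * y₀) ≈ 0#
  head-cancels y₀ y₂ = begin
    y₀ * ((- α) * y₂) + y₂ * (α * y₀)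
      ≈⟨ +-congʳ (trans (*-congˡ (sym (-‿distribˡ-* α y₂))) (sym (-‿distribʳ-* y₀ _))) ⟩
    - (y₀ * (α * y₂)) + y₂ * (α * y₀)
      ≈⟨ +-congˡ (trans (sym (*-assoc y₂ α y₀)) (trans (comm _ _) (*-congˡ (comm y₂ α)))) ⟩
    - (y₀ * (α * y₂)) + y₀ * (α * y₂)
      ≈⟨ -‿inverseˡ _ ⟩
    0# ∎

  span-singular : ∀ {d} (f : Fin d → ℕ) (adm : Admissible f) → Sparse f → TotSingular K n (span f adm)
  span-singular f adm sparse y y∈ =
    trans (+-congˡ (+-congˡ tail≈0)) (trans (+-congˡ (+-identityʳ _)) head≈0)
    where
    coord≈ : ∀ k {k<6} → coord y k ≈ y (pos k {k<6})
    coord≈ k {k<6} = reflexive (coord-at y (pos k {k<6}) (toℕ-pos k {k<6}))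
    head≈0 : coord y 0 * coord y 1 + coord y 2 * coord y 3 ≈ 0#
    head≈0 = trans (+-cong (*-cong (coord≈ 0) (trans (coord≈ 1) (span-obeys₂₁ f adm y y∈)))
                           (*-cong (coord≈ 2) (trans (coord≈ 3) (span-obeys₀₃ f adm y y∈))))
                   (head-cancels (y p₀) (y p₂))
    pair-term : ∀ a → 2 ≤ a → coord y (2 ℕ.* a) * coord y (suc (2 ℕ.* a)) ≈ 0#
    pair-term a 2≤a with sparse a 2≤a
    ... | inj₁ miss = trans (*-congʳ (coord-zero y _ (span-vanishes f _ 4≤2a miss y y∈))) (zeroˡ _)
      where
      4≤2a : 4 ≤ 2 ℕ.* a
      4≤2a = ℕP.*-monoʳ-≤ 2 2≤a
    ... | inj₂ miss = trans (*-congˡ (coord-zero y _ (span-vanishes f _ 4≤2a+1 miss y y∈))) (zeroʳ _)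
      where
      4≤2a+1 : 4 ≤ suc (2 ℕ.* a)
      4≤2a+1 = ℕP.m≤n⇒m≤1+n (ℕP.*-monoʳ-≤ 2 2≤a)
    tail≈0 : sumK {suc m} (λ i → coord y (2 ℕ.* toℕ (Fin.suc (Fin.suc i)))
                               * coord y (suc (2 ℕ.* toℕ (Fin.suc (Fin.suc i))))) ≈ 0#
    tail≈0 = sumK-0 {suc m} (λ i → pair-term (2 ℕ.+ toℕ i) (s≤s (s≤s z≤n)))

  -- L's positions 6, 8, …, 2n − 2; M⁺ adds 4 and M⁻ adds 5.
  fL : Fin m → ℕ
  fL k = 2 ℕ.* (3 ℕ.+ toℕ k)

  fL-even : ∀ k a → ¬ fL k P.≡ suc (2 ℕ.* a)
  fL-even k = ℕP.even≢odd (3 ℕ.+ toℕ k)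

  fL≢4 : ∀ k → ¬ fL k P.≡ 4
  fL≢4 k e with ℕP.suc-injective (ℕP.suc-injective (ℕP.*-cancelˡ-≡ (3 ℕ.+ toℕ k) 2 2 e))
  ... | ()

  adm-L : Admissible fL
  adm-L = record
    { high      = λ k → ℕP.*-monoʳ-≤ 2 {2} {3 ℕ.+ toℕ k} (s≤s (s≤s z≤n))
    ; bounded   = λ k → ℕP.*-monoʳ-< 2 (s≤s (s≤s (s≤s (FinP.toℕ<n k))))
    ; injective = λ i j e → FinP.toℕ-injective
        (ℕP.suc-injective (ℕP.suc-injective (ℕP.suc-injective (ℕP.*-cancelˡ-≡ _ _ 2 e)))) }

  adm⁺ : Admissible (cons 4 fL)
  adm⁺ = cons-admissible 4 fL ℕP.≤-refl (ℕP.<-≤-trans (s≤s (s≤s (s≤s (s≤s (s≤s z≤n))))) 6≤W) fL≢4 adm-L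

  adm⁻ : Admissible (cons 5 fL)
  adm⁻ = cons-admissible 5 fL (ℕP.n≤1+n 4) (ℕP.<-≤-trans ℕP.≤-refl 6≤W) (λ k → fL-even k 2) adm-L

  L : Sub W (suc (suc m))
  L = span fL adm-L

  M⁺ M⁻ : Sub W n
  M⁺ = span (cons 4 fL) adm⁺
  M⁻ = span (cons 5 fL) adm⁻

  sparse⁺ : Sparse (cons 4 fL)
  sparse⁺ a _ = inj₂ λ { Fin.zero → ℕP.even≢odd 2 a ; (Fin.suc k) → fL-even k a }

  sparse⁻ : Sparse (cons 5 fL)
  sparse⁻ 1 (s≤s ())
  sparse⁻ 2 _ = inj₁ λ { Fin.zero () ; (Fin.suc k) → fL≢4 k }
  sparse⁻ (suc (suc (suc a))) _ = inj₂ λ { Fin.zero → 5≢ ; (Fin.suc k) → fL-even k (3 ℕ.+ a) }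
    where
    5≢ : ¬ 5 P.≡ suc (2 ℕ.* (3 ℕ.+ a))
    5≢ e with ℕP.*-cancelˡ-≡ 2 (3 ℕ.+ a) 2 (ℕP.suc-injective e)
    ... | ()

  L-in : ∀ a i → gens fL i ∈⟨ gens (cons a fL) ⟩
  L-in a Fin.zero              = mem-basis (gens (cons a fL)) Fin.zero
  L-in a (Fin.suc Fin.zero)    = mem-basis (gens (cons a fL)) (Fin.suc Fin.zero)
  L-in a (Fin.suc (Fin.suc k)) = mem-basis (gens (cons a fL)) (Fin.suc (Fin.suc (Fin.suc k)))

  fL-in-P₊ : ∀ k → unitV (fL k) ∈⟨ P₊ K n ⟩
  fL-in-P₊ k = mem-basis (P₊ K n) (Fin.suc (Fin.suc (Fin.suc k)))

  meet-in-L : ∀ a b → Admissible (cons b fL) → ¬ a P.≡ b → (∀ k → ¬ fL k P.≡ b) →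
    ∀ v → v ∈⟨ gens (cons a fL) ⟩ → v ∈⟨ gens (cons b fL) ⟩ → v ∈ L
  meet-in-L a b adm-b a≢b fL≢b v v∈a v∈b = drop-first b fL adm-b v v∈b
    (span-vanishes (cons a fL) b (high adm-b Fin.zero) (λ { Fin.zero → a≢b ; (Fin.suc k) → fL≢b k }) v v∈a)

  M⁺∩M⁻⊆L : ∀ v → v ∈ M⁺ → v ∈ M⁻ → v ∈ L
  M⁺∩M⁻⊆L = meet-in-L 4 5 adm⁻ (λ ()) (λ k → fL-even k 2)

  -- M⁺ and M⁻ are incident: they meet in the hyperplane L of both.
  M⁺-M⁻ : DimInter M⁺ (basis M⁻) (n ∸ 1)
  M⁺-M⁻ = dim-inter-intro M⁺ (basis M⁻) (basis L) (indep L) (L-in 4) (L-in 5) M⁺∩M⁻⊆L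

  M⁻-M⁺ : DimInter M⁻ (basis M⁺) (n ∸ 1)
  M⁻-M⁺ = dim-inter-intro M⁻ (basis M⁺) (basis L) (indep L) (L-in 5) (L-in 4) (λ v v∈M⁻ v∈M⁺ → M⁺∩M⁻⊆L v v∈M⁺ v∈M⁻)

  -- M⁺ ∩ P₊ = ⟨e₄, e₆, …, e_{2n−2}⟩ has codimension 2 in M⁺ …
  M⁺∩P₊ : DimInter M⁺ (P₊ K n) (suc m)
  M⁺∩P₊ = dim-inter-intro M⁺ (P₊ K n) (units (cons 4 fL)) (priv-indep (units (cons 4 fL)) (units-priv (cons 4 fL) adm⁺))
    (λ i → mem-basis (gens (cons 4 fL)) (Fin.suc (Fin.suc i)))
    (λ { Fin.zero → mem-basis (P₊ K n) (Fin.suc (Fin.suc Fin.zero)) ; (Fin.suc k) → fL-in-P₊ k })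
    (λ v v∈M v∈P → odd-low-vanish (cons 4 fL) adm⁺ v v∈M (P₊-odd 0 v v∈P) (P₊-odd 1 v v∈P))

  -- … while M⁻ ∩ P₊ = ⟨e₆, …, e_{2n−2}⟩ has codimension 3 in M⁻.
  M⁻∩P₊ : DimInter M⁻ (P₊ K n) m
  M⁻∩P₊ = dim-inter-intro M⁻ (P₊ K n) (units fL) (priv-indep (units fL) (units-priv fL adm-L))
    (λ i → mem-basis (gens (cons 5 fL)) (Fin.suc (Fin.suc (Fin.suc i))))
    fL-in-P₊
    (λ v v∈M v∈P → odd-low-vanish fL adm-L v (drop-first 5 fL adm⁻ v v∈M (P₊-odd 2 v v∈P))
                     (P₊-odd 0 v v∈P) (P₊-odd 1 v v∈P))

  ¬2∣3 : ¬ (2 ∣ 3)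
  ¬2∣3 (divides zero ())
  ¬2∣3 (divides (suc zero) ())
  ¬2∣3 (divides (suc (suc q)) ())

  point : Sub W 1
  point = record
    { basis = λ _ → u
    ; indep = priv-indep (λ _ → u) ((λ _ → p₀) , λ { Fin.zero Fin.zero → u-p₀ }) }

  point⊆ : ∀ {d} (f : Fin d → ℕ) (adm : Admissible f) → point ⊆ span f adm
  point⊆ f adm = ⊆-intro point (span f adm) (λ _ → mem-basis (gens f) Fin.zero)

  point-elem : ElemD K n (ord Fin.zero)
  point-elem = point , (λ v v∈ → span-singular (cons 4 fL) adm⁺ sparse⁺ v (point⊆ (cons 4 fL) adm⁺ v v∈)) , UP.tt

  M⁺-elem : ElemD K n plus
  M⁺-elem = M⁺ , span-singular (cons 4 fL) adm⁺ sparse⁺ ,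
    (suc m , M⁺∩P₊ , P.subst (2 ∣_) (P.sym (ℕP.m+n∸n≡m 2 m)) ∣-refl)

  M⁻-elem : ElemD K n minus
  M⁻-elem = M⁻ , span-singular (cons 5 fL) adm⁻ sparse⁻ ,
    (m , M⁻∩P₊ , λ 2∣ → ¬2∣3 (P.subst (2 ∣_) (ℕP.m+n∸n≡m 3 m) 2∣))

  B : Building (c ⊔ ℓ) (c ⊔ ℓ ⊔ ℓ₀)
  B = D-building K K0 n

  -- The flag {⟨u⟩, M⁺, M⁻} of type {1, +, −}; the three points are restrictions of it.
  flag-elem : ∀ t → T (J-D-1pm n t) → ElemD K n t
  flag-elem (ord Fin.zero)    _ = point-elem
  flag-elem (ord (Fin.suc i)) ()
  flag-elem plus              _ = M⁺-elem
  flag-elem minus             _ = M⁻-elem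

  flag-incident : ∀ s t fs ft → Building.Inc B (flag-elem s fs) (flag-elem t ft)
  flag-incident (ord Fin.zero)    (ord Fin.zero)    _ _  = inj₁ (⊆-refl point)
  flag-incident (ord Fin.zero)    plus              _ _  = inj₁ (point⊆ (cons 4 fL) adm⁺)
  flag-incident (ord Fin.zero)    minus             _ _  = inj₁ (point⊆ (cons 5 fL) adm⁻)
  flag-incident plus              (ord Fin.zero)    _ _  = inj₂ (point⊆ (cons 4 fL) adm⁺)
  flag-incident plus              plus              _ _  = inj₁ (⊆-refl M⁺)
  flag-incident plus              minus             _ _  = M⁺-M⁻
  flag-incident minus             (ord Fin.zero)    _ _  = inj₂ (point⊆ (cons 5 fL) adm⁻)
  flag-incident minus             plus              _ _  = M⁻-M⁺
  flag-incident minus             minus             _ _  = inj₁ (⊆-refl M⁻)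
  flag-incident (ord (Fin.suc i)) _                 () _
  flag-incident (ord Fin.zero)    (ord (Fin.suc i)) _ ()
  flag-incident plus              (ord (Fin.suc i)) _ ()
  flag-incident minus             (ord (Fin.suc i)) _ ()

  restrict : (J : DType n → Bool) → (∀ t → T (J t) → T (J-D-1pm n t)) → Point B J
  restrict J J⊆ = (λ t t∈J → flag-elem t (J⊆ t t∈J)) ,
                  λ s t s∈J t∈J → flag-incident s t (J⊆ s s∈J) (J⊆ t t∈J)

  -- No element of the flag is rational: each lies in M⁺ or M⁻ and contains u.
  flag-irrational : ∀ t ft → ¬ RatSub K0 (proj₁ (flag-elem t ft))
  flag-irrational (ord Fin.zero) _ rat =
    rational-obeys-excludes point rat α∉K0 p₀ p₃
      (obeys-⊆ point M⁺ p₀ p₃ α (point⊆ (cons 4 fL) adm⁺) (span-obeys₀₃ (cons 4 fL) adm⁺)) u (mem-basis (basis point) Fin.zero) u-p₀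
  flag-irrational plus _ rat =
    rational-obeys-excludes M⁺ rat α∉K0 p₀ p₃ (span-obeys₀₃ (cons 4 fL) adm⁺) u (mem-basis (basis M⁺) Fin.zero) u-p₀
  flag-irrational minus _ rat =
    rational-obeys-excludes M⁻ rat α∉K0 p₀ p₃ (span-obeys₀₃ (cons 5 fL) adm⁻) u (mem-basis (basis M⁻) Fin.zero) u-p₀

  ord-refute : ∀ i (x : ElemD K n (ord i)) → RatSub K0 (proj₁ x) →
    SymInc (proj₁ x) M⁻ → SymInc (proj₁ x) point → ⊥
  ord-refute i x rat x~M⁻ x~point =
    rational-between (proj₁ x) rat α∉K0 M⁻ p₀ p₃ (span-obeys₀₃ (cons 5 fL) adm⁻)
      (s≤s (ℕP.m≤n⇒m≤1+n (FinP.toℕ<n i))) x~M⁻ point u-p₀ x~point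

  n-2<n : suc m < n
  n-2<n = s≤s (ℕP.n≤1+n (suc m))

  -- A rational (n − 2)-space is not incident with both M⁺ and M⁻: it would lie
  -- in L, so by rationality in ⟨e₆, …, e_{2n−2}⟩, of dimension n − 3.
  last-refute : ∀ {d} (x : Sub W (suc d)) → d P.≡ m → RatSub K0 x → SymInc x M⁺ → SymInc x M⁻ → ⊥
  last-refute x P.refl rat (inj₂ M⁺⊆x) _            = ⊆-dim M⁺ x M⁺⊆x n-2<n
  last-refute x P.refl rat (inj₁ _)     (inj₂ M⁻⊆x) = ⊆-dim M⁻ x M⁻⊆x n-2<n
  last-refute x P.refl rat (inj₁ x⊆M⁺) (inj₁ x⊆M⁻) =
    rational-obeys-vanishes x rat α∉K0 p₀ p₃ (obeys-⊆ x L p₀ p₃ α x⊆L (span-obeys₀₃ fL adm-L)) λ v₀≈0 →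
    rational-obeys-vanishes x rat (irrational-neg α∉K0) p₂ p₁
      (obeys-⊆ x L p₂ p₁ (- α) x⊆L (span-obeys₂₁ fL adm-L)) λ v₂≈0 →
    steinitz (basis x) (indep x) (units fL)
      (λ i → drop-uw fL adm-L _ (x⊆L _ (b∈x i)) (v₀≈0 _ (b∈x i)) (v₂≈0 _ (b∈x i))) (ℕP.n<1+n m)
    where
    x⊆L : x ⊆ L
    x⊆L v v∈x = M⁺∩M⁻⊆L v (x⊆M⁺ v v∈x) (x⊆M⁻ v v∈x)
    b∈x : ∀ i → basis x i ∈ x
    b∈x = mem-basis (basis x)

  DAdj-sym : ∀ {x y} → DAdj n x y → DAdj n y x
  DAdj-sym {ord i} {ord j} (inj₁ e) = inj₂ e
  DAdj-sym {ord i} {ord j} (inj₂ e) = inj₁ e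
  DAdj-sym {ord i} {plus}  e = e
  DAdj-sym {ord i} {minus} e = e
  DAdj-sym {plus}  {ord j} e = e
  DAdj-sym {minus} {ord j} e = e

  open Paths B DAdj-sym

  -- ord i, ord (i + 1), …, ord (n − 3), minus: a path avoiding plus.
  ord-to-minus : ∀ k (i : Fin (suc m)) → k ℕ.+ toℕ i P.≡ m → ConnWithout B plus (ord i) minus
  ord-to-minus zero    i i≡m = step (λ ()) (P.cong suc i≡m) (here (λ ()))
  ord-to-minus (suc k) i k+1+i≡m = step (λ ()) (inj₁ (P.sym toℕ-next)) (ord-to-minus k next k+next≡m)
    where
    k+i+1≡m : k ℕ.+ suc (toℕ i) P.≡ m
    k+i+1≡m = P.trans (ℕP.+-suc k (toℕ i)) k+1+i≡m
    i+1<m+1 : suc (toℕ i) < suc m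
    i+1<m+1 = s≤s (P.subst (suc (toℕ i) ≤_) k+i+1≡m (ℕP.m≤n+m (suc (toℕ i)) k))
    next : Fin (suc m)
    next = Fin.fromℕ< i+1<m+1
    toℕ-next : toℕ next P.≡ suc (toℕ i)
    toℕ-next = FinP.toℕ-fromℕ< i+1<m+1
    k+next≡m : k ℕ.+ toℕ next P.≡ m
    k+next≡m = P.trans (P.cong (k ℕ.+_) toℕ-next) k+i+1≡m

  -- the last ordinary node n − 2, adjacent to plus and minus
  last : Fin (suc m)
  last = Fin.fromℕ m

  last-adj : suc (toℕ last) P.≡ n ∸ 2
  last-adj = P.cong suc (FinP.toℕ-fromℕ m)

  not-nearly-rational-1m : NotAllNearlyRational B (J-D-1m n)
  not-nearly-rational-1m all with all (restrict (J-D-1m n) J⊆)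
    where
    J⊆ : ∀ t → T (J-D-1m n t) → T (J-D-1pm n t)
    J⊆ (ord i) t∈J = t∈J
    J⊆ minus   t∈J = t∈J
  ... | inj₁ (t , _ , rat)                        = flag-irrational t _ rat
  ... | inj₂ (minus , _ , (() , _) , _)
  ... | inj₂ (ord i , x , _ , rat , incident)     = ord-refute i x rat (incident minus _) (incident (ord Fin.zero) _)
  ... | inj₂ (plus , _ , (_ , disconnected) , _)  = disconnected (connected-via-hub (J-D-1m n) to-minus)
    where
    -- removing plus leaves 1 and − connected
    to-minus : ∀ x → T (J-D-1m n x) → ConnWithout B plus x minus
    to-minus (ord Fin.zero)    _ = ord-to-minus m Fin.zero (ℕP.+-identityʳ m)
    to-minus (ord (Fin.suc i)) ()
    to-minus minus             _ = here (λ ())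

  not-nearly-rational-1pm : NotAllNearlyRational B (J-D-1pm n)
  not-nearly-rational-1pm all with all (restrict (J-D-1pm n) (λ _ t∈J → t∈J))
  ... | inj₁ (t , _ , rat)                    = flag-irrational t _ rat
  ... | inj₂ (plus , _ , (() , _) , _)
  ... | inj₂ (minus , _ , (() , _) , _)
  ... | inj₂ (ord i , x , _ , rat , incident) = ord-refute i x rat (incident minus _) (incident (ord Fin.zero) _)

  not-nearly-rational-pm : NotAllNearlyRational B (J-D-pm n)
  not-nearly-rational-pm all with all (restrict (J-D-pm n) J⊆)
    where
    J⊆ : ∀ t → T (J-D-pm n t) → T (J-D-1pm n t)
    J⊆ plus  t∈J = t∈J
    J⊆ minus t∈J = t∈J
  ... | inj₁ (t , _ , rat)                = flag-irrational t _ rat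
  ... | inj₂ (plus , _ , (() , _) , _)
  ... | inj₂ (minus , _ , (() , _) , _)
  ... | inj₂ (ord i , x , (_ , disconnected) , rat , incident) with toℕ i ℕ.≟ m
  ...   | yes i≡m = last-refute (proj₁ x) i≡m rat (incident plus _) (incident minus _)
  ...   | no  i≢m = disconnected (connected-via-hub (J-D-pm n) to-last)
    where
    -- only the node n − 2 separates + from −
    last≢i : ¬ ord last P.≡ ord i
    last≢i P.refl = i≢m (FinP.toℕ-fromℕ m)
    to-last : ∀ x → T (J-D-pm n x) → ConnWithout B (ord i) x (ord last)
    to-last plus  _ = step (λ ()) last-adj (here last≢i)
    to-last minus _ = step (λ ()) last-adj (here last≢i)

from-3 : ∀ {p} (P : ℕ → Set p) → (∀ m → P (suc (suc (suc m)))) → ∀ n → 3 ≤ n → P n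
from-3 P h (suc (suc (suc m))) _                 = h m
from-3 P h (suc zero)          (s≤s ())
from-3 P h (suc (suc zero))    (s≤s (s≤s ()))

from-4 : ∀ {p} (P : ℕ → Set p) → (∀ m → P (suc (suc (suc m)))) → ∀ n → 4 ≤ n → P n
from-4 P h n 4≤n = from-3 P h n (ℕP.≤-trans (ℕP.n≤1+n 3) 4≤n)

lemma3p7 : ∀ {c ℓ ℓ₀} (K : DivisionRing c ℓ) (K0 : DivisionRing.Carrier K → Set ℓ₀)
    → IsSubDivisionRing K K0 → Proper K K0
    → (∀ n → 3 ≤ n → NotAllNearlyRational (A-building K K0 n) (J-A-1n n))
      × (IsCommutative K
         → (∀ n → 4 ≤ n → NotAllNearlyRational (D-building K K0 n) (J-D-1m n))
           × (∀ n → 4 ≤ n → NotAllNearlyRational (D-building K K0 n) (J-D-1pm n))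
           × (∀ n → 3 ≤ n → NotAllNearlyRational (D-building K K0 n) (J-D-pm n)))
lemma3p7 K K0 sub (α , α∉K0) =
  from-3 (λ n → NotAllNearlyRational (A-building K K0 n) (J-A-1n n))
         (λ m → FlagA.not-nearly-rational K K0 sub α α∉K0 (suc (suc m))) ,
  λ comm →
    from-4 (λ n → NotAllNearlyRational (D-building K K0 n) (J-D-1m n))
           (FlagD.not-nearly-rational-1m K K0 sub α α∉K0 comm) ,
    from-4 (λ n → NotAllNearlyRational (D-building K K0 n) (J-D-1pm n))
           (FlagD.not-nearly-rational-1pm K K0 sub α α∉K0 comm) ,
    from-3 (λ n → NotAllNearlyRational (D-building K K0 n) (J-D-pm n))
           (FlagD.not-nearly-rational-pm K K0 sub α α∉K0 comm)
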